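{- Let $p$ be a prime with $p-1$ divisible by $4$, and let $u_1=\left(\frac{p-1}{2}\right)!\in\mathbb{F}_p$, so that $u_1$ and $-u_1$ are the square roots of $-1$ in $\mathbb{F}_p$. Let $G=\{a\in\mathbb{F}_{p^4}: a^{p^2}+a=0\}$, let $G_1,\dots,G_{p+1}$ be its $p+1$ subgroups of order $p$ (the additive subgroups generated by non-zero elements of $G$), and let $\phi_1:a\mapsto a^p$ on $\mathbb{F}_{p^4}$. Then among the $G_i$ there are exactly two subgroups stable under $\phi_1$, namely the set of solutions in $\mathbb{F}_{p^4}$ of $x^p=u_1x$ and the set of solutions of $x^p=-u_1x$. Moreover, if some $G_i$ is not stable under $\phi_1$, then its image $\phi_1(G_i)$ is another subgroup $G_j$, one has $\phi_1(G_j)=G_i$, and $\phi_1$ is a bijection from $G_i$ onto $G_j$. -}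

module Defs where

open import Level using (Level; _⊔_; Lift)
open import Algebra.Bundles using (CommutativeRing; Semiring)
open import Data.Nat using (ℕ; _∸_; _/_)
open import Data.Nat using (_!)
open import Data.Fin using (Fin)
open import Data.Product using (Σ; ∃; _×_; _,_)
open import Relation.Nullary using (¬_)
open import Function.Bundles using (Inverse)
import Relation.Binary.PropositionalEquality as ≡

-- A field, presented as a commutative ring with 1 ≠ 0 in which every
-- non-zero element has a multiplicative inverse (agda-stdlib has no Field bundle).
record IsField {c ℓ : Level} (R : CommutativeRing c ℓ) : Set (c ⊔ ℓ) where
  open CommutativeRing R
  field
    1≉0     : ¬ (1# ≈ 0#)
    inverse : ∀ x → ¬ (x ≈ 0#) → ∃ λ y → x * y ≈ 1#

HasOrder : {c ℓ : Level} → CommutativeRing c ℓ → ℕ → Set (c ⊔ ℓ)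
HasOrder R n = Inverse (CommutativeRing.setoid R) (≡.setoid (Fin n))

module Notions {c ℓ : Level} (R : CommutativeRing c ℓ) (p : ℕ) where
  open CommutativeRing R
  open import Algebra.Definitions.RawSemiring (Semiring.rawSemiring semiring) renaming (_×_ to _·_) using (_^_)

  Subset : Set (Level.suc (c ⊔ ℓ))
  Subset = Carrier → Set (c ⊔ ℓ)

  _≐_ : Subset → Subset → Set (c ⊔ ℓ)
  A ≐ B = ∀ x → (A x → B x) × (B x → A x)

  φ₁ : Carrier → Carrier
  φ₁ a = a ^ p

  φ₁[_] : Subset → Subset
  φ₁[ A ] y = ∃ λ x → A x × (y ≈ φ₁ x)

  G : Subset
  G a = Lift c ((a ^ (p Data.Nat.* p)) + a ≈ 0#)

  -- the additive subgroup generated by a (= {k·a : k ∈ ℕ}, since R is finite)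
  ⟨_⟩ : Carrier → Subset
  ⟨ a ⟩ x = Lift c (∃ λ (k : ℕ) → x ≈ k · a)

  u₁ : Carrier
  u₁ = (((p ∸ 1) / 2) !) · 1#

  Sol : Carrier → Subset
  Sol k x = Lift c (φ₁ x ≈ k * x)

  -- "G_i is a subgroup G_⟨a⟩ for a non-zero a ∈ G"
  Gen : Carrier → Set (c ⊔ ℓ)
  Gen a = G a × ¬ (a ≈ 0#)

  Stable : Subset → Set (c ⊔ ℓ)
  Stable A = φ₁[ A ] ≐ A

  BijOn : Subset → Subset → Set (c ⊔ ℓ)
  BijOn A B =
    (∀ x → A x → B (φ₁ x)) ×
    (∀ x y → A x → A y → φ₁ x ≈ φ₁ y → x ≈ y) ×
    (∀ y → B y → ∃ λ x → A x × (φ₁ x ≈ y))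

{-# OPTIONS --safe #-}
module Submission where

-- Write φ₁ x = xᵖ and 𝔽ₚ = {n · 1}. Since |F| = p⁴, counting gives p · 1 = 0 and x^(p⁴) = x, so φ₁ is
-- an injective ring endomorphism (binomial theorem) with φ₁⁴ = 1. Its fixed points are exactly 𝔽ₚ: a
-- non-zero fixed point is a root of t^(p-1) - 1 = ∏ⱼ (t - j)(t + j), j = 1, …, (p-1)/2, and evaluating
-- this factorisation at t = 0 gives u₁² = -1 when 4 ∣ p - 1.
-- For a ∈ G ∖ {0}, ⟨a⟩ = 𝔽ₚ a, so ⟨a⟩ is φ₁-stable iff φ₁ a = κ a with κ ∈ 𝔽ₚ; as φ₁² = -1 on G this
-- forces κ² = -1, i.e. κ = ±u₁, and then ⟨a⟩ is the line Sol (±u₁). These lines are non-zero: for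
-- ε = ±u₁, U = (φ₁ + ε)(φ₁² - 1) is a monic polynomial map of degree p³ < |F|, so it has a non-root,
-- and its values lie in Sol ε as (φ₁ - ε) U = φ₁⁴ - 1 = 0. A non-stable ⟨a⟩ is mapped bijectively onto
-- ⟨φ₁ a⟩, and that onto ⟨-a⟩ = ⟨a⟩.

open import Defs
open import Level using (lift; lower)
open import Algebra.Bundles using (CommutativeRing; Monoid)
open import Data.Nat as ℕ using (ℕ; zero; suc; _∸_; _!; z≤n; s≤s; z<s; s<s)
import Data.Nat.Properties as ℕ
open import Data.Nat.Divisibility using (_∣_; divides)
open import Data.Nat.Primality using (Prime)
open import Data.Integer as ℤ using (ℤ; +_; -[1+_]; _⊖_)
import Data.Integer.Properties as ℤ
open import Data.Sign as Sign using (Sign)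
open import Data.Maybe using (Maybe; just; nothing)
open import Data.Product using (∃; _×_; _,_; proj₁; proj₂)
open import Data.Sum as Sum using (_⊎_; inj₁; inj₂)
open import Data.Empty using (⊥-elim)
open import Relation.Nullary using (¬_; yes; no; does)
open import Data.Bool using (if_then_else_)
open import Relation.Binary using (Decidable)
open import Relation.Binary.PropositionalEquality as ≡ using (_≡_; _≢_)
import Algebra.Solver.Ring
import Algebra.Properties.Semiring.Mult as SemiringMult
import Algebra.Solver.Ring.AlmostCommutativeRing as ACR

module ℤ-Coefficients {c ℓ} (R : CommutativeRing c ℓ) where
  open CommutativeRing R
  open import Algebra.Properties.Ring ring
    using (-0#≈0#; -‿involutive; -‿distribˡ-*; -‿distribʳ-*; -‿+-comm)
  open import Algebra.Properties.Semiring.Mult semiring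
    using (×-homo-+; ×1-homo-*) renaming (_×_ to _·_)
  open import Relation.Binary.Reasoning.Setoid setoid

  ⟦_⟧ : ℤ → Carrier
  ⟦ + n ⟧      = n · 1#
  ⟦ -[1+ n ] ⟧ = - (suc n · 1#)

  private
    1+a-[1+b]≈a-b : ∀ a b → (1# + a) - (1# + b) ≈ a - b
    1+a-[1+b]≈a-b a b = begin
      (1# + a) + - (1# + b)    ≈⟨ +-cong (+-comm 1# a) (sym (-‿+-comm 1# b)) ⟩
      (a + 1#) + (- 1# + - b)  ≈⟨ +-assoc a 1# _ ⟩
      a + (1# + (- 1# + - b))  ≈⟨ +-congˡ (+-assoc 1# (- 1#) (- b)) ⟨
      a + ((1# + - 1#) + - b)  ≈⟨ +-congˡ (+-congʳ (-‿inverseʳ 1#)) ⟩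
      a + (0# + - b)           ≈⟨ +-congˡ (+-identityˡ (- b)) ⟩
      a + - b                  ∎

  ⟦⊖⟧ : ∀ m n → ⟦ m ⊖ n ⟧ ≈ m · 1# - n · 1#
  ⟦⊖⟧ zero    zero    = sym (trans (+-congˡ -0#≈0#) (+-identityʳ 0#))
  ⟦⊖⟧ (suc m) zero    = sym (trans (+-congˡ -0#≈0#) (+-identityʳ _))
  ⟦⊖⟧ zero    (suc n) = sym (+-identityˡ _)
  ⟦⊖⟧ (suc m) (suc n) rewrite ℤ.[1+m]⊖[1+n]≡m⊖n m n =
    trans (⟦⊖⟧ m n) (sym (1+a-[1+b]≈a-b (m · 1#) (n · 1#)))

  ⟦+⟧ : ∀ i j → ⟦ i ℤ.+ j ⟧ ≈ ⟦ i ⟧ + ⟦ j ⟧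
  ⟦+⟧ (+ m)    (+ n)    = ×-homo-+ 1# m n
  ⟦+⟧ (+ m)    -[1+ n ] = ⟦⊖⟧ m (suc n)
  ⟦+⟧ -[1+ m ] (+ n)    = trans (⟦⊖⟧ n (suc m)) (+-comm _ _)
  ⟦+⟧ -[1+ m ] -[1+ n ] = begin
    - (suc (suc (m ℕ.+ n)) · 1#)     ≡⟨ ≡.cong (λ k → - (suc k · 1#)) (ℕ.+-suc m n) ⟨
    - ((suc m ℕ.+ suc n) · 1#)       ≈⟨ -‿cong (×-homo-+ 1# (suc m) (suc n)) ⟩
    - (suc m · 1# + suc n · 1#)      ≈⟨ -‿+-comm _ _ ⟨
    - (suc m · 1#) + - (suc n · 1#)  ∎

  ⟦-⟧ : ∀ i → ⟦ ℤ.- i ⟧ ≈ - ⟦ i ⟧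
  ⟦-⟧ -[1+ n ]    = sym (-‿involutive _)
  ⟦-⟧ (+ zero)    = sym -0#≈0#
  ⟦-⟧ (+ (suc n)) = refl

  private
    signed : Sign → Carrier → Carrier
    signed Sign.+ x = x
    signed Sign.- x = - x

    ⟦◃⟧ : ∀ s n → ⟦ s ℤ.◃ n ⟧ ≈ signed s (n · 1#)
    ⟦◃⟧ Sign.+ zero    = refl
    ⟦◃⟧ Sign.- zero    = sym -0#≈0#
    ⟦◃⟧ Sign.+ (suc n) = refl
    ⟦◃⟧ Sign.- (suc n) = refl

    ⟦⟧-sign-abs : ∀ i → ⟦ i ⟧ ≈ signed (ℤ.sign i) (ℤ.∣ i ∣ · 1#)
    ⟦⟧-sign-abs (+ n)    = refl
    ⟦⟧-sign-abs -[1+ n ] = refl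

    signed-cong : ∀ s {x y} → x ≈ y → signed s x ≈ signed s y
    signed-cong Sign.+ x≈y = x≈y
    signed-cong Sign.- x≈y = -‿cong x≈y

    signed-* : ∀ s t x y → signed (s Sign.* t) (x * y) ≈ signed s x * signed t y
    signed-* Sign.+ Sign.+ x y = refl
    signed-* Sign.+ Sign.- x y = -‿distribʳ-* x y
    signed-* Sign.- Sign.+ x y = -‿distribˡ-* x y
    signed-* Sign.- Sign.- x y = begin
      x * y        ≈⟨ -‿involutive _ ⟨
      - - (x * y)  ≈⟨ -‿cong (-‿distribʳ-* x y) ⟩
      - (x * - y)  ≈⟨ -‿distribˡ-* x (- y) ⟩
      - x * - y    ∎

  ⟦*⟧ : ∀ i j → ⟦ i ℤ.* j ⟧ ≈ ⟦ i ⟧ * ⟦ j ⟧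
  ⟦*⟧ i j = begin
    ⟦ s ℤ.◃ (∣i∣ ℕ.* ∣j∣) ⟧                ≈⟨ ⟦◃⟧ s (∣i∣ ℕ.* ∣j∣) ⟩
    signed s ((∣i∣ ℕ.* ∣j∣) · 1#)          ≈⟨ signed-cong s (×1-homo-* ∣i∣ ∣j∣) ⟩
    signed s ((∣i∣ · 1#) * (∣j∣ · 1#))     ≈⟨ signed-* (ℤ.sign i) (ℤ.sign j) _ _ ⟩
    signed (ℤ.sign i) (∣i∣ · 1#) * signed (ℤ.sign j) (∣j∣ · 1#)
                                           ≈⟨ *-cong (⟦⟧-sign-abs i) (⟦⟧-sign-abs j) ⟨
    ⟦ i ⟧ * ⟦ j ⟧                          ∎
    where
    s = ℤ.sign i Sign.* ℤ.sign j
    ∣i∣ = ℤ.∣ i ∣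
    ∣j∣ = ℤ.∣ j ∣

  ℤ⟶R : ℤ.+-*-rawRing ACR.-Raw-AlmostCommutative⟶ ACR.fromCommutativeRing R
  ℤ⟶R = record
    { ⟦_⟧ = ⟦_⟧ ; +-homo = ⟦+⟧ ; *-homo = ⟦*⟧ ; -‿homo = ⟦-⟧
    ; 0-homo = refl ; 1-homo = +-identityʳ 1# }

  ⟦⟧-equal? : ∀ i j → Maybe (⟦ i ⟧ ≈ ⟦ j ⟧)
  ⟦⟧-equal? i j with i ℤ.≟ j
  ... | yes ≡.refl = just refl
  ... | no _       = nothing

  open Algebra.Solver.Ring ℤ.+-*-rawRing (ACR.fromCommutativeRing R) ℤ⟶R ⟦⟧-equal? public
    using (solve; _:+_; _:*_; :-_; _:-_; _:=_; con)

module RingProperties {c ℓ} (R : CommutativeRing c ℓ) where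
  open CommutativeRing R
  open ℤ-Coefficients R using (solve; _:*_; :-_; _:=_)
  open import Algebra.Properties.Semiring.Exp semiring using (_^_; ^-congʳ; ^-assocʳ)
  open import Algebra.Properties.Ring ring using (-1*x≈-x)
  open SemiringMult semiring using (×1-homo-*; ×-congʳ; ×-assoc-*) renaming (_×_ to _·_)

  0^n≈0 : ∀ {n} → ℕ.NonZero n → 0# ^ n ≈ 0#
  0^n≈0 {suc n} _ = zeroˡ _

  ^-·1 : ∀ n k → (n ℕ.^ k) · 1# ≈ (n · 1#) ^ k
  ^-·1 n zero    = +-identityʳ 1#
  ^-·1 n (suc k) = trans (×1-homo-* n (n ℕ.^ k)) (*-congˡ (^-·1 n k))

  1^n≈1 : ∀ n → 1# ^ n ≈ 1#
  1^n≈1 zero    = refl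
  1^n≈1 (suc n) = trans (*-identityˡ _) (1^n≈1 n)

  ^-comm : ∀ x m n → (x ^ m) ^ n ≈ (x ^ n) ^ m
  ^-comm x m n = trans (^-assocʳ x m n) (trans (^-congʳ x (ℕ.*-comm m n)) (sym (^-assocʳ x n m)))

  ·≈·1* : ∀ n x → n · x ≈ (n · 1#) * x
  ·≈·1* n x = trans (×-congʳ n (sym (*-identityˡ x))) (sym (×-assoc-* n 1# x))

  √-1*[√-1*x]≈-x : ∀ {i} → i * i ≈ - 1# → ∀ x → i * (i * x) ≈ - x
  √-1*[√-1*x]≈-x {i} i*i≈-1 x = trans (sym (*-assoc i i x)) (trans (*-congʳ i*i≈-1) (-1*x≈-x x))

  -x^[k*2]≈x^[k*2] : ∀ k x → (- x) ^ (k ℕ.* 2) ≈ x ^ (k ℕ.* 2)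
  -x^[k*2]≈x^[k*2] zero    x = refl
  -x^[k*2]≈x^[k*2] (suc k) x = trans (*-congˡ (*-congˡ (-x^[k*2]≈x^[k*2] k x)))
    (solve 2 (λ x y → (:- x) :* ((:- x) :* y) := x :* (x :* y)) refl x (x ^ (k ℕ.* 2)))

module FieldProperties {c ℓ} (F : CommutativeRing c ℓ) (isField : IsField F) where
  open CommutativeRing F
  open IsField isField
  open ℤ-Coefficients F using (solve; _:+_; _:*_; _:-_; _:=_)
  open import Algebra.Properties.Semiring.Exp semiring using (_^_)
  open import Algebra.Properties.Ring ring using (-‿involutive; -0#≈0#; x∙y⁻¹≈ε⇒x≈y; +-inverseˡ-unique)
  open import Relation.Binary.Reasoning.Setoid setoid

  *-cancelˡ : ∀ {a x y} → a ≉ 0# → a * x ≈ a * y → x ≈ y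
  *-cancelˡ {a} {x} {y} a≉0 ax≈ay with inverse a a≉0
  ... | a⁻¹ , aa⁻¹≈1 = begin
    x              ≈⟨ *-identityˡ x ⟨
    1# * x         ≈⟨ *-congʳ (trans (*-comm a⁻¹ a) aa⁻¹≈1) ⟨
    (a⁻¹ * a) * x  ≈⟨ *-assoc a⁻¹ a x ⟩
    a⁻¹ * (a * x)  ≈⟨ *-congˡ ax≈ay ⟩
    a⁻¹ * (a * y)  ≈⟨ *-assoc a⁻¹ a y ⟨
    (a⁻¹ * a) * y  ≈⟨ *-congʳ (trans (*-comm a⁻¹ a) aa⁻¹≈1) ⟩
    1# * y         ≈⟨ *-identityˡ y ⟩
    y              ∎

  *-cancelʳ : ∀ {a x y} → a ≉ 0# → x * a ≈ y * a → x ≈ y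
  *-cancelʳ a≉0 xa≈ya = *-cancelˡ a≉0 (trans (*-comm _ _) (trans xa≈ya (*-comm _ _)))

  x*y≈0⇒y≈0 : ∀ {x y} → x ≉ 0# → x * y ≈ 0# → y ≈ 0#
  x*y≈0⇒y≈0 {x} x≉0 xy≈0 = *-cancelˡ x≉0 (trans xy≈0 (sym (zeroʳ x)))

  *-≉0 : ∀ {x y} → x ≉ 0# → y ≉ 0# → x * y ≉ 0#
  *-≉0 x≉0 y≉0 xy≈0 = y≉0 (x*y≈0⇒y≈0 x≉0 xy≈0)

  √-1≉0 : ∀ {i} → i * i ≈ - 1# → i ≉ 0#
  √-1≉0 {i} i*i≈-1 i≈0 = 1≉0 (begin
    1#        ≈⟨ -‿involutive 1# ⟨
    - - 1#    ≈⟨ -‿cong (trans (sym i*i≈-1) (trans (*-congʳ i≈0) (zeroˡ i))) ⟩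
    - 0#      ≈⟨ -0#≈0# ⟩
    0#        ∎)

  ^-≉0 : ∀ {x} → x ≉ 0# → ∀ n → x ^ n ≉ 0#
  ^-≉0 x≉0 zero    = 1≉0
  ^-≉0 x≉0 (suc n) = *-≉0 x≉0 (^-≉0 x≉0 n)

  module _ (_≟_ : Decidable _≈_) where

    x*y≈0⇒x≈0⊎y≈0 : ∀ {x y} → x * y ≈ 0# → x ≈ 0# ⊎ y ≈ 0#
    x*y≈0⇒x≈0⊎y≈0 {x} xy≈0 with x ≟ 0#
    ... | yes x≈0 = inj₁ x≈0
    ... | no  x≉0 = inj₂ (x*y≈0⇒y≈0 x≉0 xy≈0)

    √-1≈± : ∀ {i κ} → i * i ≈ - 1# → κ * κ ≈ - 1# → κ ≈ i ⊎ κ ≈ - i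
    √-1≈± {i} {κ} i*i≈-1 κ*κ≈-1 =
      Sum.map (x∙y⁻¹≈ε⇒x≈y κ i) (+-inverseˡ-unique κ i) (x*y≈0⇒x≈0⊎y≈0 (begin
        (κ - i) * (κ + i)    ≈⟨ solve 2 (λ k i → (k :- i) :* (k :+ i) := k :* k :- i :* i) refl κ i ⟩
        κ * κ - i * i        ≈⟨ +-cong κ*κ≈-1 (-‿cong i*i≈-1) ⟩
        - 1# - - 1#          ≈⟨ -‿inverseʳ (- 1#) ⟩
        0#                   ∎))

    ^≈0⇒≈0 : ∀ {x} n → x ^ n ≈ 0# → x ≈ 0#
    ^≈0⇒≈0 {x} n xⁿ≈0 with x ≟ 0#
    ... | yes x≈0 = x≈0
    ... | no  x≉0 = ⊥-elim (^-≉0 x≉0 n xⁿ≈0)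

module Polynomials {c ℓ} (F : CommutativeRing c ℓ) (isField : IsField F)
                   (_≟_ : Decidable (CommutativeRing._≈_ F)) where
  open CommutativeRing F
  open IsField isField using (1≉0)
  open FieldProperties F isField
  open ℤ-Coefficients F using (solve; _:+_; _:*_; _:-_; _:=_)
  open import Algebra.Properties.CommutativeSemigroup *-commutativeSemigroup using (x∙yz≈y∙xz)
  open import Algebra.Properties.Semiring.Exp semiring using (_^_)
  open import Algebra.Properties.Ring ring using (x∙y⁻¹≈ε⇒x≈y)
  open import Relation.Binary.Reasoning.Setoid setoid
  open import Data.Vec using (Vec; []; _∷_; replicate; zipWith)
  open import Data.Vec.Relation.Unary.All as All using (All; []; _∷_)
  open import Data.Vec.Relation.Unary.Any using (Any; here; there)
  open import Data.Vec.Relation.Unary.AllPairs using (AllPairs; []; _∷_)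

  -- monic cs t = tⁿ + Σᵢ csᵢ tⁱ for cs of length n: coefficients from low to high, leading 1 implicit
  monic : ∀ {n} → Vec Carrier n → Carrier → Carrier
  monic []       t = 1#
  monic (c ∷ cs) t = c + t * monic cs t

  ∏[_-_] : ∀ {n} → Carrier → Vec Carrier n → Carrier
  ∏[ t - [] ]     = 1#
  ∏[ t - r ∷ rs ] = (t - r) * ∏[ t - rs ]

  Root : ∀ {n} → Vec Carrier n → Carrier → Set ℓ
  Root cs r = monic cs r ≈ 0#

  quotient : ∀ {n} → Carrier → Vec Carrier (suc n) → Vec Carrier n
  quotient r (c ∷ [])      = []
  quotient r (c ∷ d ∷ cs) = monic (d ∷ cs) r ∷ quotient r (d ∷ cs)

  monic-division : ∀ {n} r (cs : Vec Carrier (suc n)) t →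
                   monic cs t ≈ (t - r) * monic (quotient r cs) t + monic cs r
  monic-division r (c ∷ []) t =
    solve 4 (λ c t r o → c :+ t :* o := (t :- r) :* o :+ (c :+ r :* o)) refl c t r 1#
  monic-division r (c ∷ d ∷ cs) t = begin
    c + t * monic (d ∷ cs) t        ≈⟨ +-congˡ (*-congˡ (monic-division r (d ∷ cs) t)) ⟩
    c + t * ((t - r) * Q + E)       ≈⟨ solve 5 (λ c t r Q E → c :+ t :* ((t :- r) :* Q :+ E)
                                                := (t :- r) :* (E :+ t :* Q) :+ (c :+ r :* E)) refl c t r Q E ⟩
    (t - r) * (E + t * Q) + (c + r * E) ∎
    where
    Q = monic (quotient r (d ∷ cs)) t
    E = monic (d ∷ cs) r

  monic-factor : ∀ {n} (cs rs : Vec Carrier n) → AllPairs _≉_ rs → All (Root cs) rs →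
                 ∀ t → monic cs t ≈ ∏[ t - rs ]
  monic-factor []       []       _                _                t = refl
  monic-factor (c ∷ cs) (r ∷ rs) (r≉rs ∷ rs-distinct) (r-root ∷ rs-roots) t = begin
    monic (c ∷ cs) t                ≈⟨ monic-division r (c ∷ cs) t ⟩
    (t - r) * monic Q t + monic (c ∷ cs) r ≈⟨ +-cong (*-congˡ (monic-factor Q rs rs-distinct Q-roots t)) r-root ⟩
    (t - r) * ∏[ t - rs ] + 0#      ≈⟨ +-identityʳ _ ⟩
    ∏[ t - r ∷ rs ]                 ∎
    where
    Q = quotient r (c ∷ cs)
    Q-root : ∀ {s} → r ≉ s → Root (c ∷ cs) s → Root Q s
    Q-root {s} r≉s s-root = x*y≈0⇒y≈0 (λ s-r≈0 → r≉s (sym (x∙y⁻¹≈ε⇒x≈y s r s-r≈0))) (begin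
      (s - r) * monic Q s            ≈⟨ +-identityʳ _ ⟨
      (s - r) * monic Q s + 0#       ≈⟨ +-congˡ r-root ⟨
      (s - r) * monic Q s + monic (c ∷ cs) r ≈⟨ monic-division r (c ∷ cs) s ⟨
      monic (c ∷ cs) s               ≈⟨ s-root ⟩
      0#                             ∎)
    Q-roots : All (Root Q) rs
    Q-roots = All.map (λ (r≉s , s-root) → Q-root r≉s s-root) (All.zip (r≉rs , rs-roots))

  ∏-≉0 : ∀ {n t} {rs : Vec Carrier n} → All (t ≉_) rs → ∏[ t - rs ] ≉ 0#
  ∏-≉0 []              = 1≉0
  ∏-≉0 {t = t} {r ∷ _} (t≉r ∷ t≉rs) =
    *-≉0 (λ t-r≈0 → t≉r (x∙y⁻¹≈ε⇒x≈y t r t-r≈0)) (∏-≉0 t≉rs)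

  ∏≈0⇒∈ : ∀ {n t} (rs : Vec Carrier n) → ∏[ t - rs ] ≈ 0# → Any (t ≈_) rs
  ∏≈0⇒∈ []       ∏≈0 = ⊥-elim (1≉0 ∏≈0)
  ∏≈0⇒∈ {t = t} (r ∷ rs) ∏≈0 with x*y≈0⇒x≈0⊎y≈0 _≟_ ∏≈0
  ... | inj₁ t-r≈0 = here (x∙y⁻¹≈ε⇒x≈y t r t-r≈0)
  ... | inj₂ ∏′≈0  = there (∏≈0⇒∈ rs ∏′≈0)

  monic-roots≤degree : ∀ {n} (cs : Vec Carrier n) {t} {rs : Vec Carrier n} →
                       AllPairs _≉_ (t ∷ rs) → ¬ All (Root cs) (t ∷ rs)
  monic-roots≤degree cs {t} {rs} (t≉rs ∷ rs-distinct) (t-root ∷ rs-roots) =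
    ∏-≉0 t≉rs (trans (sym (monic-factor cs rs rs-distinct rs-roots t)) t-root)

  monic-root∈ : ∀ {n} {cs rs : Vec Carrier n} → AllPairs _≉_ rs → All (Root cs) rs →
                ∀ {t} → Root cs t → Any (t ≈_) rs
  monic-root∈ {cs = cs} {rs} rs-distinct rs-roots {t} t-root =
    ∏≈0⇒∈ rs (trans (sym (monic-factor cs rs rs-distinct rs-roots t)) t-root)

  eval : ∀ {n} → Vec Carrier n → Carrier → Carrier
  eval []       t = 0#
  eval (c ∷ cs) t = c + t * eval cs t

  monic≈^+eval : ∀ {n} (cs : Vec Carrier n) t → monic cs t ≈ t ^ n + eval cs t
  monic≈^+eval []       t = sym (+-identityʳ 1#)
  monic≈^+eval {suc n} (c ∷ cs) t = begin
    c + t * monic cs t                ≈⟨ +-congˡ (*-congˡ (monic≈^+eval cs t)) ⟩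
    c + t * (tⁿ + eval cs t)          ≈⟨ solve 4 (λ c t tⁿ e → c :+ t :* (tⁿ :+ e) := t :* tⁿ :+ (c :+ t :* e))
                                           refl c t tⁿ (eval cs t) ⟩
    t * tⁿ + (c + t * eval cs t)      ∎
    where tⁿ = t ^ n

  eval-+ : ∀ {n} (xs ys : Vec Carrier n) t → eval (zipWith _+_ xs ys) t ≈ eval xs t + eval ys t
  eval-+ []       []       t = sym (+-identityʳ 0#)
  eval-+ (x ∷ xs) (y ∷ ys) t = begin
    (x + y) + t * eval (zipWith _+_ xs ys) t    ≈⟨ +-congˡ (*-congˡ (eval-+ xs ys t)) ⟩
    (x + y) + t * (eval xs t + eval ys t)       ≈⟨ solve 5 (λ x y t a b → (x :+ y) :+ t :* (a :+ b)
                                                     := (x :+ t :* a) :+ (y :+ t :* b)) refl x y t _ _ ⟩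
    (x + t * eval xs t) + (y + t * eval ys t)   ∎

  -- the coefficients of a tᵏ among t⁰, …, tⁿ⁻¹ (all zero if k ≥ n)
  monomial : ∀ {n} → ℕ → Carrier → Vec Carrier n
  monomial {zero}  _       a = []
  monomial {suc n} zero    a = a ∷ replicate n 0#
  monomial {suc n} (suc k) a = 0# ∷ monomial k a

  eval-replicate-0# : ∀ n t → eval (replicate n 0#) t ≈ 0#
  eval-replicate-0# zero    t = refl
  eval-replicate-0# (suc n) t = trans (+-identityˡ _) (trans (*-congˡ (eval-replicate-0# n t)) (zeroʳ t))

  eval-monomial : ∀ {n k} → k ℕ.< n → ∀ a t → eval (monomial {n} k a) t ≈ a * t ^ k
  eval-monomial {suc n} {zero} _ a t = begin
    a + t * eval (replicate n 0#) t  ≈⟨ +-congˡ (trans (*-congˡ (eval-replicate-0# n t)) (zeroʳ t)) ⟩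
    a + 0#                           ≈⟨ +-identityʳ a ⟩
    a                                ≈⟨ *-identityʳ a ⟨
    a * 1#                           ∎
  eval-monomial {suc n} {suc k} (s≤s k<n) a t = begin
    0# + t * eval (monomial {n} k a) t  ≈⟨ +-identityˡ _ ⟩
    t * eval (monomial {n} k a) t       ≈⟨ *-congˡ (eval-monomial k<n a t) ⟩
    t * (a * t ^ k)                  ≈⟨ x∙yz≈y∙xz t a (t ^ k) ⟩
    a * (t * t ^ k)                  ∎

module MonoidSum {a ℓ} (M : Monoid a ℓ) where
  open Monoid M
  open import Algebra.Properties.Monoid.Sum M using (sum)
  open import Data.Fin using (Fin; zero; suc; inject₁; fromℕ)
  open import Data.Fin.Properties using (suc-injective)
  open import Data.Vec.Functional using (Vector)

  sum-last : ∀ {n} (t : Vector Carrier (suc n)) → (∀ i → t (inject₁ i) ≈ ε) → sum t ≈ t (fromℕ n)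
  sum-last {zero}  t _   = identityʳ _
  sum-last {suc n} t t≈ε = trans (∙-cong (t≈ε zero) (sum-last (λ i → t (suc i)) (λ i → t≈ε (suc i)))) (identityˡ _)

  sum-single : ∀ {n} (t : Vector Carrier n) i → (∀ j → j ≢ i → t j ≈ ε) → sum t ≈ t i
  sum-single {suc n} t zero    t≈ε = trans (∙-congˡ (sum-ones (λ j → t≈ε (suc j) λ ()))) (identityʳ _)
    where
    sum-ones : ∀ {m} {u : Vector Carrier m} → (∀ j → u j ≈ ε) → sum u ≈ ε
    sum-ones {zero}  u≈ε = refl
    sum-ones {suc m} u≈ε = trans (∙-cong (u≈ε zero) (sum-ones (λ j → u≈ε (suc j)))) (identityˡ ε)
  sum-single {suc n} t (suc i) t≈ε =
    trans (∙-congʳ (t≈ε zero λ ())) (trans (identityˡ _)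
          (sum-single (λ j → t (suc j)) i (λ j j≢i → t≈ε (suc j) (λ sj≡si → j≢i (suc-injective sj≡si)))))

module FiniteField {c ℓ} (F : CommutativeRing c ℓ) (isField : IsField F) {q} (order : HasOrder F q) where
  open CommutativeRing F
  open IsField isField using (1≉0; inverse)
  open RingProperties F using (0^n≈0)
  open FieldProperties F isField
  open ℤ-Coefficients F using (solve; _:+_; _:-_; _:=_)
  open import Algebra.Properties.Semiring.Exp semiring using (_^_; ^-congˡ)
  open import Algebra.Properties.Semiring.Mult semiring using () renaming (_×_ to _·_)
  open import Algebra.Properties.Ring ring using (+-identityʳ-unique)
  open import Relation.Binary.Reasoning.Setoid setoid
  open import Data.Fin as Fin using (Fin)
  open import Data.Fin.Properties using (nonZeroIndex; ¬∀⟶∃¬; inject≤-injective)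
  open import Data.Fin.Permutation using (Permutation; _⟨$⟩ʳ_)
  open import Data.Vec using (Vec; tabulate)
  open import Data.Vec.Functional using (Vector)
  import Data.Vec.Relation.Unary.All.Properties as All
  import Data.Vec.Relation.Unary.AllPairs.Properties as AllPairs
  open import Function.Bundles using (Inverse; mk↔ₛ′)
  open import Function.Properties.Inverse using (Inverse⇒Injection)
  open import Relation.Nullary.Decidable using (via-injection)
  import Algebra.Properties.CommutativeMonoid.Sum as CommutativeMonoidSum
  module ∑ = CommutativeMonoidSum +-commutativeMonoid
  module ∏ = CommutativeMonoidSum *-commutativeMonoid
  open Inverse order using (to; from; to-cong; strictlyInverseˡ; strictlyInverseʳ)

  -- opaque, so that `with x ≟ 0#` can abstract it in goals
  opaque
    _≟_ : Decidable _≈_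
    _≟_ = via-injection (Inverse⇒Injection order) Fin._≟_

  from-injective : ∀ {i j} → from i ≈ from j → i ≡ j
  from-injective {i} {j} fi≈fj = ≡.trans (≡.sym (strictlyInverseˡ i)) (≡.trans (to-cong fi≈fj) (strictlyInverseˡ j))

  private
    permutation : (f g : Carrier → Carrier) →
                  (∀ {x y} → x ≈ y → f x ≈ f y) → (∀ {x y} → x ≈ y → g x ≈ g y) →
                  (∀ x → f (g x) ≈ x) → (∀ x → g (f x) ≈ x) → Permutation q q
    permutation f g f-cong g-cong fg≈id gf≈id = mk↔ₛ′ (λ i → to (f (from i))) (λ i → to (g (from i)))
      (λ i → ≡.trans (to-cong (trans (f-cong (strictlyInverseʳ _)) (fg≈id _))) (strictlyInverseˡ i))
      (λ i → ≡.trans (to-cong (trans (g-cong (strictlyInverseʳ _)) (gf≈id _))) (strictlyInverseˡ i))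

  q·1≈0 : q · 1# ≈ 0#
  q·1≈0 = +-identityʳ-unique (∑.sum from) (q · 1#) (sym (begin
    ∑.sum from                                  ≈⟨ ∑.∑-permute from π ⟩
    ∑.sum (λ i → from (π ⟨$⟩ʳ i))               ≈⟨ ∑.sum-cong-≋ (λ i → strictlyInverseʳ (from i + 1#)) ⟩
    ∑.sum (λ i → from i + 1#)                   ≈⟨ ∑.∑-distrib-+ from (λ _ → 1#) ⟩
    ∑.sum from + ∑.sum {q} (λ _ → 1#)           ≈⟨ +-congˡ (∑.sum-replicate q) ⟩
    ∑.sum from + q · 1#                         ∎))
    where
    π = permutation (_+ 1#) (_- 1#) +-congʳ +-congʳ
          (λ x → solve 2 (λ x o → (x :- o) :+ o := x) refl x 1#)
          (λ x → solve 2 (λ x o → (x :+ o) :- o := x) refl x 1#)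

  private
    nonzeroPart : Carrier → Carrier
    nonzeroPart x = if does (x ≟ 0#) then 1# else x

    atZero : Carrier → Carrier → Carrier
    atZero a x = if does (x ≟ 0#) then a else 1#

    nonzeroPart-cong : ∀ {x y} → x ≈ y → nonzeroPart x ≈ nonzeroPart y
    nonzeroPart-cong {x} {y} x≈y with x ≟ 0# | y ≟ 0#
    ... | yes _   | yes _   = refl
    ... | yes x≈0 | no  y≉0 = ⊥-elim (y≉0 (trans (sym x≈y) x≈0))
    ... | no  x≉0 | yes y≈0 = ⊥-elim (x≉0 (trans x≈y y≈0))
    ... | no  _   | no  _   = x≈y

    nonzeroPart-≉0 : ∀ x → nonzeroPart x ≉ 0#
    nonzeroPart-≉0 x with x ≟ 0#
    ... | yes _   = 1≉0
    ... | no  x≉0 = x≉0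

    nonzeroPart-* : ∀ {a} → a ≉ 0# → ∀ x → nonzeroPart (a * x) * atZero a x ≈ a * nonzeroPart x
    nonzeroPart-* {a} a≉0 x with x ≟ 0# | (a * x) ≟ 0#
    ... | yes _   | yes _    = *-comm 1# a
    ... | yes x≈0 | no  ax≉0 = ⊥-elim (ax≉0 (trans (*-congˡ x≈0) (zeroʳ a)))
    ... | no  x≉0 | yes ax≈0 = ⊥-elim (*-≉0 a≉0 x≉0 ax≈0)
    ... | no  _   | no  _    = *-identityʳ _

    ∏-atZero : ∀ a → ∏.sum (λ i → atZero a (from i)) ≈ a
    ∏-atZero a = trans (MonoidSum.sum-single *-monoid _ (to 0#) atZero≈1) (atZero-0 (strictlyInverseʳ 0#))
      where
      atZero-0 : ∀ {x} → x ≈ 0# → atZero a x ≈ a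
      atZero-0 {x} x≈0 with x ≟ 0#
      ... | yes _   = refl
      ... | no  x≉0 = ⊥-elim (x≉0 x≈0)
      atZero≈1 : ∀ j → j ≢ to 0# → atZero a (from j) ≈ 1#
      atZero≈1 j j≢z with from j ≟ 0#
      ... | yes fj≈0 = ⊥-elim (j≢z (≡.trans (≡.sym (strictlyInverseˡ j)) (to-cong fj≈0)))
      ... | no  _    = refl

    ∏-≉0 : ∀ {n} (t : Vector Carrier n) → (∀ i → t i ≉ 0#) → ∏.sum t ≉ 0#
    ∏-≉0 {zero}  t t≉0 = 1≉0
    ∏-≉0 {suc n} t t≉0 = *-≉0 (t≉0 Fin.zero) (∏-≉0 (λ i → t (Fin.suc i)) (λ i → t≉0 (Fin.suc i)))

  -- For P the product of the non-zero elements, x P ≈ xᵠ P: multiplication by x ≉ 0 permutes them,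
  -- and atZero x supplies the factor x that is missing at 0.
  fermat : ∀ x → x ^ q ≈ x
  fermat x with x ≟ 0#
  ... | yes x≈0 = trans (^-congˡ q x≈0) (trans (0^n≈0 (nonZeroIndex (to 0#))) (sym x≈0))
  ... | no x≉0 = sym (*-cancelʳ (∏-≉0 _ (λ i → nonzeroPart-≉0 (from i))) (begin
    x * P                                                         ≈⟨ *-comm x P ⟩
    P * x                                                         ≈⟨ *-cong (∏.∑-permute _ π) (sym (∏-atZero x)) ⟩
    ∏.sum (λ i → nonzeroPart (from (π ⟨$⟩ʳ i))) * ∏.sum (λ i → atZero x (from i))
               ≈⟨ *-congʳ (∏.sum-cong-≋ (λ i → nonzeroPart-cong (strictlyInverseʳ (x * from i)))) ⟩
    ∏.sum (λ i → nonzeroPart (x * from i)) * ∏.sum (λ i → atZero x (from i))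
               ≈⟨ ∏.∑-distrib-+ (λ i → nonzeroPart (x * from i)) (λ i → atZero x (from i)) ⟨
    ∏.sum (λ i → nonzeroPart (x * from i) * atZero x (from i))
               ≈⟨ ∏.sum-cong-≋ (λ i → nonzeroPart-* x≉0 (from i)) ⟩
    ∏.sum (λ i → x * nonzeroPart (from i))
               ≈⟨ ∏.∑-distrib-+ (λ _ → x) (λ i → nonzeroPart (from i)) ⟩
    ∏.sum {q} (λ _ → x) * P    ≈⟨ *-congʳ (∏.sum-replicate q) ⟩
    x ^ q * P                  ∎))
    where
    P = ∏.sum (λ i → nonzeroPart (from i))
    x⁻¹ = proj₁ (inverse x x≉0)
    xx⁻¹≈1 = proj₂ (inverse x x≉0)
    π = permutation (x *_) (x⁻¹ *_) *-congˡ *-congˡ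
          (λ y → trans (sym (*-assoc x x⁻¹ y)) (trans (*-congʳ xx⁻¹≈1) (*-identityˡ y)))
          (λ y → trans (sym (*-assoc x⁻¹ x y)) (trans (*-congʳ (trans (*-comm x⁻¹ x) xx⁻¹≈1)) (*-identityˡ y)))

  open Polynomials F isField _≟_ using (monic; monic-roots≤degree)

  ∃-nonroot : ∀ {n} → n ℕ.< q → (cs : Vec Carrier n) → ∃ λ t → monic cs t ≉ 0#
  ∃-nonroot {n} n<q cs =
    let i , i-nonroot = ¬∀⟶∃¬ q (λ i → monic cs (from i) ≈ 0#) (λ i → monic cs (from i) ≟ 0#) not-all-roots
    in from i , i-nonroot
    where
    f : Fin (suc n) → Carrier
    f i = from (Fin.inject≤ i n<q)
    not-all-roots : ¬ (∀ i → monic cs (from i) ≈ 0#)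
    not-all-roots all-roots = monic-roots≤degree cs {f Fin.zero} {tabulate (λ i → f (Fin.suc i))}
      (AllPairs.tabulate⁺ {f = f} (λ i≢j fi≈fj → i≢j (inject≤-injective n<q n<q _ _ (from-injective fi≈fj))))
      (All.tabulate⁺ {f = f} (λ i → all-roots _))

module _ {p} (p-prime : Prime p) where
  open import Data.Nat.Combinatorics using (_C_; nCk≡n!/k![n-k]!; k![n∸k]!∣n!)
  open import Data.Nat.Divisibility using (∣1⇒≡1; ∣⇒≤; m∣m*n)
  open import Data.Nat.DivMod using (m/n*n≡m)
  open import Data.Nat.Primality using (euclidsLemma; ¬prime[1]; prime⇒nonZero)

  prime∤! : ∀ {j} → j ℕ.< p → ¬ p ∣ j !
  prime∤! {zero}  _   p∣1 = ¬prime[1] (≡.subst Prime (∣1⇒≡1 p∣1) p-prime)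
  prime∤! {suc j} j<p p∣j! with euclidsLemma (suc j) (j !) p-prime p∣j!
  ... | inj₁ p∣1+j = ℕ.<⇒≱ j<p (∣⇒≤ p∣1+j)
  ... | inj₂ p∣j!  = prime∤! (ℕ.<-trans (ℕ.n<1+n j) j<p) p∣j!

  prime∣choose : ∀ {k} → 0 ℕ.< k → k ℕ.< p → p ∣ p C k
  prime∣choose {k} 0<k k<p with euclidsLemma (p C k) (k ! ℕ.* (p ∸ k) !) p-prime (≡.subst (p ∣_) p!≡ p∣p!)
    where
    p!≡ : p ! ≡ (p C k) ℕ.* (k ! ℕ.* (p ∸ k) !)
    p!≡ = ≡.sym (≡.trans (≡.cong (ℕ._* (k ! ℕ.* (p ∸ k) !)) (nCk≡n!/k![n-k]! (ℕ.<⇒≤ k<p)))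
                         (m/n*n≡m {{ℕ._!*_!≢0 k (p ∸ k)}} (k![n∸k]!∣n! (ℕ.<⇒≤ k<p))))
    n∣n! : ∀ {n} → ℕ.NonZero n → n ∣ n !
    n∣n! {suc n} _ = m∣m*n (n !)
    p∣p! : p ∣ p !
    p∣p! = n∣n! (prime⇒nonZero p-prime)
  ... | inj₁ p∣pCk = p∣pCk
  ... | inj₂ p∣k![p-k]! with euclidsLemma (k !) ((p ∸ k) !) p-prime p∣k![p-k]!
  ...   | inj₁ p∣k!     = ⊥-elim (prime∤! k<p p∣k!)
  ...   | inj₂ p∣[p-k]! = ⊥-elim (prime∤! (ℕ.∸-monoʳ-< {p} {k} {0} 0<k (ℕ.<⇒≤ k<p)) p∣[p-k]!)

CharacteristicDivides : ∀ {c ℓ} → CommutativeRing c ℓ → ℕ → Set ℓ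
CharacteristicDivides R n = n · 1# ≈ 0#
  where
  open CommutativeRing R
  open SemiringMult semiring using () renaming (_×_ to _·_)

module Frobenius {c ℓ} (R : CommutativeRing c ℓ) {p} (p-prime : Prime p) (p·1≈0 : CharacteristicDivides R p) where
  open CommutativeRing R
  open SemiringMult semiring using () renaming (_×_ to _·_)
  open Notions R p using (φ₁)
  open RingProperties R using (0^n≈0; 1^n≈1; ·≈·1*)
  open SemiringMult semiring using (×-congʳ; ×-congˡ; ×1-homo-*; ×-homo-1)
  open import Algebra.Properties.Semiring.Exp semiring using (_^_; ^-congˡ; ^-assocʳ)
  open import Algebra.Properties.CommutativeSemiring.Exp commutativeSemiring using (^-distrib-*)
  open import Algebra.Properties.Ring ring using (+-inverseʳ-unique)
  import Algebra.Properties.CommutativeSemiring.Binomial commutativeSemiring as Binomial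
  open import Algebra.Properties.Monoid.Sum +-monoid using (sum)
  open import Data.Nat.Combinatorics using (_C_; nCn≡1)
  open import Data.Nat.Primality using (prime⇒nonZero)
  open import Data.Fin as Fin using (inject₁; fromℕ)
  open import Data.Fin.Properties using (toℕ-inject₁; toℕ-fromℕ; toℕ<n)
  open import Data.Nat.GeneralisedArithmetic using (fold)
  open import Relation.Binary.Reasoning.Setoid setoid

  p∣n⇒n·x≈0 : ∀ {n} x → p ∣ n → n · x ≈ 0#
  p∣n⇒n·x≈0 x (divides d ≡.refl) = begin
    (d ℕ.* p) · x                ≈⟨ ·≈·1* (d ℕ.* p) x ⟩
    ((d ℕ.* p) · 1#) * x         ≈⟨ *-congʳ (×1-homo-* d p) ⟩
    ((d · 1#) * (p · 1#)) * x    ≈⟨ *-congʳ (trans (*-congˡ p·1≈0) (zeroʳ _)) ⟩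
    0# * x                       ≈⟨ zeroˡ x ⟩
    0#                           ∎

  p≡1+[p∸1] : p ≡ suc (p ∸ 1)
  p≡1+[p∸1] = ≡.sym (ℕ.suc-pred p {{prime⇒nonZero p-prime}})

  -x≈[p∸1]·x : ∀ x → - x ≈ (p ∸ 1) · x
  -x≈[p∸1]·x x = sym (+-inverseʳ-unique x ((p ∸ 1) · x)
    (trans (sym (×-congˡ {x} p≡1+[p∸1])) (p∣n⇒n·x≈0 x (divides 1 (≡.sym (ℕ.*-identityˡ p))))))

  freshman's-dream : ∀ m → (∀ {k} → 0 ℕ.< k → k ℕ.< suc m → ∀ z → (suc m C k) · z ≈ 0#) →
                     ∀ x y → (x + y) ^ suc m ≈ x ^ suc m + y ^ suc m
  freshman's-dream m inner≈0 x y = begin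
    (x + y) ^ suc m                        ≈⟨ Binomial.theorem (suc m) x y ⟩
    T Fin.zero + sum (λ i → T (Fin.suc i)) ≈⟨ +-congˡ (MonoidSum.sum-last +-monoid (λ i → T (Fin.suc i)) inner) ⟩
    T Fin.zero + T (Fin.suc (fromℕ m))     ≈⟨ +-cong first last ⟩
    y ^ suc m + x ^ suc m                  ≈⟨ +-comm _ _ ⟩
    x ^ suc m + y ^ suc m                  ∎
    where
    T = Binomial.binomialTerm x y (suc m)
    inner : ∀ i → T (Fin.suc (inject₁ i)) ≈ 0#
    inner i = inner≈0 (s≤s z≤n) (s≤s (≡.subst (ℕ._< m) (≡.sym (toℕ-inject₁ i)) (toℕ<n i))) _
    first : T Fin.zero ≈ y ^ suc m
    first = trans (×-homo-1 _) (*-identityˡ _)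
    last : T (Fin.suc (fromℕ m)) ≈ x ^ suc m
    last rewrite toℕ-fromℕ m | nCn≡1 (suc m) | ℕ.n∸n≡0 m = trans (×-homo-1 _) (*-identityʳ _)

  φ₁-cong : ∀ {x y} → x ≈ y → φ₁ x ≈ φ₁ y
  φ₁-cong = ^-congˡ p

  φ₁-+ : ∀ x y → φ₁ (x + y) ≈ φ₁ x + φ₁ y
  φ₁-+ x y = begin
    (x + y) ^ p                    ≡⟨ ≡.cong ((x + y) ^_) p≡1+[p∸1] ⟩
    (x + y) ^ suc (p ∸ 1)          ≈⟨ freshman's-dream (p ∸ 1) inner≈0 x y ⟩
    x ^ suc (p ∸ 1) + y ^ suc (p ∸ 1) ≡⟨ ≡.cong (λ n → x ^ n + y ^ n) p≡1+[p∸1] ⟨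
    x ^ p + y ^ p                  ∎
    where
    inner≈0 : ∀ {k} → 0 ℕ.< k → k ℕ.< suc (p ∸ 1) → ∀ z → (suc (p ∸ 1) C k) · z ≈ 0#
    inner≈0 {k} 0<k k<p z rewrite ≡.sym p≡1+[p∸1] = p∣n⇒n·x≈0 z (prime∣choose p-prime 0<k k<p)

  φ₁-* : ∀ x y → φ₁ (x * y) ≈ φ₁ x * φ₁ y
  φ₁-* x y = ^-distrib-* x y p

  φ₁-0 : φ₁ 0# ≈ 0#
  φ₁-0 = 0^n≈0 (prime⇒nonZero p-prime)

  φ₁-1 : φ₁ 1# ≈ 1#
  φ₁-1 = 1^n≈1 p

  φ₁-‿ : ∀ x → φ₁ (- x) ≈ - φ₁ x
  φ₁-‿ x = +-inverseʳ-unique (φ₁ x) (φ₁ (- x))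
    (trans (sym (φ₁-+ x (- x))) (trans (φ₁-cong (-‿inverseʳ x)) φ₁-0))

  φ₁-· : ∀ n x → φ₁ (n · x) ≈ n · φ₁ x
  φ₁-· zero    x = φ₁-0
  φ₁-· (suc n) x = trans (φ₁-+ x (n · x)) (+-congˡ (φ₁-· n x))

  φ₁-·1 : ∀ n → φ₁ (n · 1#) ≈ n · 1#
  φ₁-·1 n = trans (φ₁-· n 1#) (×-congʳ n φ₁-1)

  φ₁ⁿ≈^pⁿ : ∀ n x → fold x φ₁ n ≈ x ^ (p ℕ.^ n)
  φ₁ⁿ≈^pⁿ zero    x = sym (*-identityʳ x)
  φ₁ⁿ≈^pⁿ (suc n) x = begin
    φ₁ (fold x φ₁ n)            ≈⟨ φ₁-cong (φ₁ⁿ≈^pⁿ n x) ⟩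
    (x ^ (p ℕ.^ n)) ^ p         ≈⟨ ^-assocʳ x (p ℕ.^ n) p ⟩
    x ^ ((p ℕ.^ n) ℕ.* p)       ≡⟨ ≡.cong (x ^_) (ℕ.*-comm (p ℕ.^ n) p) ⟩
    x ^ (p ℕ.^ suc n)           ∎

module PrimeField {c ℓ} (F : CommutativeRing c ℓ) (isField : IsField F) (_≟_ : Decidable (CommutativeRing._≈_ F))
                  {p} (p-prime : Prime p) (p·1≈0 : CharacteristicDivides F p) where
  open CommutativeRing F
  open SemiringMult semiring using () renaming (_×_ to _·_)
  open IsField isField using (1≉0)
  open Notions F p using (φ₁)
  open RingProperties F using (0^n≈0; -x^[k*2]≈x^[k*2])
  open FieldProperties F isField
  open Frobenius F p-prime p·1≈0
  open Polynomials F isField _≟_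
  open ℤ-Coefficients F using (solve; _:*_; :-_; _:-_; _:=_; con)
  open SemiringMult semiring using (×-homo-+; ×1-homo-*; ×-assocˡ)
  open import Algebra.Properties.Semiring.Exp semiring using (_^_; ^-congˡ)
  open import Algebra.Properties.Ring ring using (x∙y⁻¹≈ε⇒x≈y; +-identityʳ-unique; -‿injective; -1*x≈-x)
  open import Relation.Binary.Reasoning.Setoid setoid
  open import Data.Nat.Coprimality using (prime⇒coprime; coprime-Bézout)
  open import Data.Nat.GCD using (module Bézout)
  open import Data.Nat.Primality using (¬prime[1])
  open import Data.Vec using (Vec; []; _∷_)
  open import Data.Vec.Relation.Unary.All as All using (All; []; _∷_)
  open import Data.Vec.Relation.Unary.AllPairs using (AllPairs; []; _∷_)

  φ₁-injective : ∀ {x y} → φ₁ x ≈ φ₁ y → x ≈ y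
  φ₁-injective {x} {y} φx≈φy = x∙y⁻¹≈ε⇒x≈y x y (^≈0⇒≈0 _≟_ p (begin
    φ₁ (x - y)        ≈⟨ φ₁-+ x (- y) ⟩
    φ₁ x + φ₁ (- y)   ≈⟨ +-congˡ (φ₁-‿ y) ⟩
    φ₁ x - φ₁ y       ≈⟨ +-congʳ φx≈φy ⟩
    φ₁ y - φ₁ y       ≈⟨ -‿inverseʳ (φ₁ y) ⟩
    0#                ∎))

  private
    multiple≈0 : ∀ d {k} → k · 1# ≈ 0# → (d ℕ.* k) · 1# ≈ 0#
    multiple≈0 d k·1≈0 = trans (×1-homo-* d _) (trans (*-congˡ k·1≈0) (zeroʳ _))

    1+am≢bn : ∀ a m b n → m · 1# ≈ 0# → n · 1# ≈ 0# → 1 ℕ.+ a ℕ.* m ≢ b ℕ.* n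
    1+am≢bn a m b n m·1≈0 n·1≈0 eq = 1≉0 (begin
      1#                          ≈⟨ +-identityʳ 1# ⟨
      1# + 0#                     ≈⟨ +-congˡ (multiple≈0 a m·1≈0) ⟨
      (1 ℕ.+ a ℕ.* m) · 1#        ≡⟨ ≡.cong (_· 1#) eq ⟩
      (b ℕ.* n) · 1#              ≈⟨ multiple≈0 b n·1≈0 ⟩
      0#                          ∎)

  ×1≉0 : ∀ {n} → 0 ℕ.< n → n ℕ.< p → n · 1# ≉ 0#
  ×1≉0 {n} 0<n n<p n·1≈0 with coprime-Bézout (prime⇒coprime p-prime {{ℕ.>-nonZero 0<n}} n<p)
  ... | Bézout.+- a b 1+bn≡ap = 1+am≢bn b n a p n·1≈0 p·1≈0 1+bn≡ap
  ... | Bézout.-+ a b 1+ap≡bn = 1+am≢bn a p b n p·1≈0 n·1≈0 1+ap≡bn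

  ×1≉×1 : ∀ {m n} → m ℕ.< n → n ℕ.< p → m · 1# ≉ n · 1#
  ×1≉×1 {m} {n} m<n n<p m·1≈n·1 = ×1≉0 (ℕ.m<n⇒0<n∸m m<n) (ℕ.≤-<-trans (ℕ.m∸n≤m n m) n<p)
    (+-identityʳ-unique (m · 1#) _ (begin
      m · 1# + (n ∸ m) · 1#   ≈⟨ ×-homo-+ 1# m (n ∸ m) ⟨
      (m ℕ.+ (n ∸ m)) · 1#    ≡⟨ ≡.cong (_· 1#) (ℕ.m+[n∸m]≡n (ℕ.<⇒≤ m<n)) ⟩
      n · 1#                  ≈⟨ m·1≈n·1 ⟨
      m · 1#                  ∎))

  ×1≉-×1 : ∀ m n → 0 ℕ.< m ℕ.+ n → m ℕ.+ n ℕ.< p → m · 1# ≉ - (n · 1#)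
  ×1≉-×1 m n 0<m+n m+n<p m·1≈-n·1 = ×1≉0 0<m+n m+n<p (begin
    (m ℕ.+ n) · 1#          ≈⟨ ×-homo-+ 1# m n ⟩
    m · 1# + n · 1#         ≈⟨ +-congʳ m·1≈-n·1 ⟩
    - (n · 1#) + n · 1#     ≈⟨ -‿inverseˡ _ ⟩
    0#                      ∎)

  ±[1…_] : (k : ℕ) → Vec Carrier (k ℕ.* 2)
  ±[1… zero  ] = []
  ±[1… suc k ] = suc k · 1# ∷ - (suc k · 1#) ∷ ±[1… k ]

  _∈±[1…_] : Carrier → ℕ → Set ℓ
  r ∈±[1… k ] = ∃ λ j → (0 ℕ.< j × j ℕ.≤ k) × (r ≈ j · 1# ⊎ r ≈ - (j · 1#))

  ±[1…]-∈ : ∀ k → All (_∈±[1… k ]) ±[1… k ]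
  ±[1…]-∈ zero    = []
  ±[1…]-∈ (suc k) = (suc k , bounds , inj₁ refl) ∷ (suc k , bounds , inj₂ refl) ∷ All.map weaken (±[1…]-∈ k)
    where
    bounds = (s≤s z≤n , ℕ.≤-refl)
    weaken : ∀ {r} → r ∈±[1… k ] → r ∈±[1… suc k ]
    weaken (j , (0<j , j≤k) , r≈±j) = j , (0<j , ℕ.m≤n⇒m≤1+n j≤k) , r≈±j

  ±[1…]-distinct : ∀ k → k ℕ.* 2 ℕ.< p → AllPairs _≉_ ±[1… k ]
  ±[1…]-distinct zero    _      = []
  ±[1…]-distinct (suc k) 2k+2<p =
    (K≉-K ∷ All.map K≉ (±[1…]-∈ k)) ∷ All.map -K≉ (±[1…]-∈ k) ∷
    ±[1…]-distinct k (ℕ.<-trans (ℕ.n<1+n _) (ℕ.<-trans (ℕ.n<1+n _) 2k+2<p))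
    where
    K = suc k · 1#
    1+k+j<p : ∀ {j} → j ℕ.≤ suc k → suc k ℕ.+ j ℕ.< p
    1+k+j<p {j} j≤1+k = ℕ.≤-<-trans (ℕ.+-monoʳ-≤ (suc k) j≤1+k)
      (≡.subst (ℕ._< p) (≡.trans (ℕ.*-comm (suc k) 2) (≡.cong (suc k ℕ.+_) (ℕ.+-identityʳ (suc k)))) 2k+2<p)
    j+1+k<p : ∀ {j} → j ℕ.≤ suc k → j ℕ.+ suc k ℕ.< p
    j+1+k<p {j} j≤1+k = ≡.subst (ℕ._< p) (ℕ.+-comm (suc k) j) (1+k+j<p j≤1+k)
    K≉-K : K ≉ - K
    K≉-K = ×1≉-×1 (suc k) (suc k) (s≤s z≤n) (1+k+j<p ℕ.≤-refl)
    K≉ : ∀ {r} → r ∈±[1… k ] → K ≉ r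
    K≉ (j , (_ , j≤k) , inj₁ r≈j) K≈r =
      ×1≉×1 (s≤s j≤k) (ℕ.≤-<-trans (ℕ.m≤m+n (suc k) j) (1+k+j<p (ℕ.m≤n⇒m≤1+n j≤k))) (sym (trans K≈r r≈j))
    K≉ (j , (_ , j≤k) , inj₂ r≈-j) K≈r =
      ×1≉-×1 (suc k) j (s≤s z≤n) (1+k+j<p (ℕ.m≤n⇒m≤1+n j≤k)) (trans K≈r r≈-j)
    -K≉ : ∀ {r} → r ∈±[1… k ] → - K ≉ r
    -K≉ (j , (0<j , j≤k) , inj₁ r≈j) -K≈r =
      ×1≉-×1 j (suc k) (ℕ.≤-trans 0<j (ℕ.m≤m+n j _)) (j+1+k<p (ℕ.m≤n⇒m≤1+n j≤k)) (sym (trans -K≈r r≈j))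
    -K≉ (j , j-bounds , inj₂ r≈-j) -K≈r = K≉ (j , j-bounds , inj₁ refl) (-‿injective (trans -K≈r r≈-j))

  ∏[0-±[1…k]] : ∀ k → ∏[ 0# - ±[1… k ] ] ≈ (- 1#) ^ k * (((k !) · 1#) * ((k !) · 1#))
  ∏[0-±[1…k]] zero    = sym (trans (*-identityˡ _) (trans (*-cong (+-identityʳ 1#) (+-identityʳ 1#)) (*-identityˡ 1#)))
  ∏[0-±[1…k]] (suc k) = begin
    (0# - K) * ((0# - - K) * ∏[ 0# - ±[1… k ] ])
      ≈⟨ *-congˡ (*-congˡ (∏[0-±[1…k]] k)) ⟩
    (0# - K) * ((0# - - K) * (s * (X * X)))
      ≈⟨ solve 3 (λ K s X → (con (+ 0) :- K) :* ((con (+ 0) :- :- K) :* (s :* (X :* X)))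
                            := (:- s) :* ((K :* X) :* (K :* X))) refl K s X ⟩
    (- s) * ((K * X) * (K * X))
      ≈⟨ *-cong (-1*x≈-x s) (*-cong (×1-homo-* (suc k) (k !)) (×1-homo-* (suc k) (k !))) ⟨
    (- 1#) ^ suc k * (((suc k !) · 1#) * ((suc k !) · 1#)) ∎
    where
    K = suc k · 1#
    s = (- 1#) ^ k
    X = (k !) · 1#

  module Odd {k} (p≡1+2k : p ≡ suc (k ℕ.* 2)) where

    2k<p : k ℕ.* 2 ℕ.< p
    2k<p = ≡.subst (k ℕ.* 2 ℕ.<_) (≡.sym p≡1+2k) ℕ.≤-refl

    0<k : 0 ℕ.< k
    0<k = ℕ.n≢0⇒n>0 λ k≡0 →
      ¬prime[1] (≡.subst Prime (≡.trans p≡1+2k (≡.cong (λ k → suc (k ℕ.* 2)) k≡0)) p-prime)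

    0<2k : 0 ℕ.< k ℕ.* 2
    0<2k = ℕ.<-≤-trans 0<k (ℕ.m≤m*n k 2)

    2<p : 2 ℕ.< p
    2<p = ≡.subst (2 ℕ.<_) (≡.sym p≡1+2k) (s≤s (ℕ.*-monoˡ-≤ 2 0<k))

    x^2k≈1 : ∀ {x} → x ≉ 0# → φ₁ x ≈ x → x ^ (k ℕ.* 2) ≈ 1#
    x^2k≈1 {x} x≉0 φx≈x = *-cancelˡ x≉0 (begin
      x ^ suc (k ℕ.* 2)   ≡⟨ ≡.cong (x ^_) p≡1+2k ⟨
      φ₁ x                ≈⟨ φx≈x ⟩
      x                   ≈⟨ *-identityʳ x ⟨
      x * 1#              ∎)

    t^2k-1 : Vec Carrier (k ℕ.* 2)
    t^2k-1 = monomial 0 (- 1#)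

    monic-t^2k-1 : ∀ t → monic t^2k-1 t ≈ t ^ (k ℕ.* 2) - 1#
    monic-t^2k-1 t = trans (monic≈^+eval t^2k-1 t)
                           (+-congˡ (trans (eval-monomial 0<2k (- 1#) t) (*-identityʳ (- 1#))))

    x^2k≈1⇒root : ∀ {x} → x ^ (k ℕ.* 2) ≈ 1# → Root t^2k-1 x
    x^2k≈1⇒root {x} x^2k≈1 = trans (monic-t^2k-1 x) (trans (+-congʳ x^2k≈1) (-‿inverseʳ 1#))

    ±[1…k]-roots : All (Root t^2k-1) ±[1… k ]
    ±[1…k]-roots = All.map (λ r∈ → x^2k≈1⇒root (r^2k≈1 r∈)) (±[1…]-∈ k)
      where
      j^2k≈1 : ∀ {j} → 0 ℕ.< j → j ℕ.≤ k → (j · 1#) ^ (k ℕ.* 2) ≈ 1#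
      j^2k≈1 {j} 0<j j≤k = x^2k≈1 (×1≉0 0<j (ℕ.≤-<-trans (ℕ.≤-trans j≤k (ℕ.m≤m*n k 2)) 2k<p)) (φ₁-·1 j)
      r^2k≈1 : ∀ {r} → r ∈±[1… k ] → r ^ (k ℕ.* 2) ≈ 1#
      r^2k≈1 (j , (0<j , j≤k) , inj₁ r≈j)  = trans (^-congˡ (k ℕ.* 2) r≈j) (j^2k≈1 0<j j≤k)
      r^2k≈1 (j , (0<j , j≤k) , inj₂ r≈-j) =
        trans (^-congˡ (k ℕ.* 2) r≈-j) (trans (-x^[k*2]≈x^[k*2] k _) (j^2k≈1 0<j j≤k))

    ∈±[1…k]⇒·1 : ∀ {r} → r ∈±[1… k ] → ∃ λ n → r ≈ n · 1#
    ∈±[1…k]⇒·1 (j , _ , inj₁ r≈j)  = j , r≈j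
    ∈±[1…k]⇒·1 (j , _ , inj₂ r≈-j) =
      (p ∸ 1) ℕ.* j , trans r≈-j (trans (-x≈[p∸1]·x _) (×-assocˡ 1# (p ∸ 1) j))

    fixed⇒·1 : ∀ {x} → φ₁ x ≈ x → ∃ λ n → x ≈ n · 1#
    fixed⇒·1 {x} φx≈x with x ≟ 0#
    ... | yes x≈0 = 0 , x≈0
    ... | no  x≉0 =
      let r∈± , x≈r = All.lookupAny (±[1…]-∈ k) (monic-root∈ {cs = t^2k-1} (±[1…]-distinct k 2k<p) ±[1…k]-roots
                                                           (x^2k≈1⇒root (x^2k≈1 x≉0 φx≈x)))
          n , r≈n = ∈±[1…k]⇒·1 r∈±
      in n , trans x≈r r≈n

    wilson-half : (- 1#) ^ k * (((k !) · 1#) * ((k !) · 1#)) ≈ - 1#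
    wilson-half = begin
      (- 1#) ^ k * (((k !) · 1#) * ((k !) · 1#))
        ≈⟨ ∏[0-±[1…k]] k ⟨
      ∏[ 0# - ±[1… k ] ]
        ≈⟨ monic-factor t^2k-1 ±[1… k ] (±[1…]-distinct k 2k<p) ±[1…k]-roots 0# ⟨
      monic t^2k-1 0#        ≈⟨ monic-t^2k-1 0# ⟩
      0# ^ (k ℕ.* 2) - 1#    ≈⟨ +-congʳ (0^n≈0 (ℕ.>-nonZero 0<2k)) ⟩
      0# - 1#                ≈⟨ +-identityˡ _ ⟩
      - 1#                   ∎

module FrobeniusOnG {c ℓ} {p} (p-prime : Prime p) (4∣p∸1 : 4 ∣ p ∸ 1)
                  (F : CommutativeRing c ℓ) (isField : IsField F) (order : HasOrder F (p ℕ.^ 4)) where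
  open CommutativeRing F
  open IsField isField using (inverse)
  open Notions F p
  open RingProperties F using (^-·1; 1^n≈1; -x^[k*2]≈x^[k*2]; ^-comm; ·≈·1*; √-1*[√-1*x]≈-x)
  open FieldProperties F isField
  open FiniteField F isField order using (_≟_; q·1≈0; fermat; ∃-nonroot)
  open ℤ-Coefficients F using (solve; _:+_; _:*_; :-_; _:-_; _:=_; con)
  open SemiringMult semiring using (×-congʳ; ×-assocˡ; ×-comm-*) renaming (_×_ to _·_)
  open import Algebra.Properties.Semiring.Exp semiring using (_^_; ^-assocʳ)
  open import Algebra.Properties.Ring ring using (-‿involutive; -‿distribʳ-*; -1*x≈-x; +-inverseˡ-unique; x[y-z]≈xy-xz)
  open import Relation.Binary.Reasoning.Setoid setoid
  open import Algebra.Properties.CommutativeSemigroup *-commutativeSemigroup using (x∙yz≈y∙xz)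
  open import Data.Nat.Primality using (prime⇒nonTrivial)
  open import Data.Vec using (Vec; zipWith)
  open import Data.Nat.DivMod using (m*n/n≡m)

  p·1≈0 : CharacteristicDivides F p
  p·1≈0 = ^≈0⇒≈0 _≟_ 4 (trans (sym (^-·1 p 4)) q·1≈0)

  open Frobenius F p-prime p·1≈0
  open PrimeField F isField _≟_ p-prime p·1≈0
  open Polynomials F isField _≟_ using (monic; eval; monic≈^+eval; eval-+; monomial; eval-monomial)

  private
    e = _∣_.quotient 4∣p∸1
    k = e ℕ.* 2

    p≡1+2k : p ≡ suc (k ℕ.* 2)
    p≡1+2k = ≡.trans p≡1+[p∸1] (≡.cong suc (≡.trans (_∣_.equality 4∣p∸1) (≡.sym (ℕ.*-assoc e 2 2))))

    [p∸1]/2≡k : (p ∸ 1) ℕ./ 2 ≡ k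
    [p∸1]/2≡k = ≡.trans (≡.cong (ℕ._/ 2) (ℕ.suc-injective (≡.trans (≡.sym p≡1+[p∸1]) p≡1+2k))) (m*n/n≡m k 2)

  open Odd {k} p≡1+2k

  ≐-sym : ∀ {A B} → A ≐ B → B ≐ A
  ≐-sym A≐B x = proj₂ (A≐B x) , proj₁ (A≐B x)

  ≐-trans : ∀ {A B C} → A ≐ B → B ≐ C → A ≐ C
  ≐-trans A≐B B≐C x = (λ x∈A → proj₁ (B≐C x) (proj₁ (A≐B x) x∈A))
                    , (λ x∈C → proj₂ (A≐B x) (proj₂ (B≐C x) x∈C))

  φ₁[]-cong : ∀ {A B} → A ≐ B → φ₁[ A ] ≐ φ₁[ B ]
  φ₁[]-cong A≐B x = (λ (y , y∈A , x≈φy) → y , proj₁ (A≐B y) y∈A , x≈φy)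
                  , (λ (y , y∈B , x≈φy) → y , proj₂ (A≐B y) y∈B , x≈φy)

  Stable-resp-≐ : ∀ {A B} → A ≐ B → Stable B → Stable A
  Stable-resp-≐ A≐B stable = ≐-trans (φ₁[]-cong A≐B) (≐-trans stable (≐-sym A≐B))

  a∈⟨a⟩ : ∀ a → ⟨ a ⟩ a
  a∈⟨a⟩ a = lift (1 , sym (+-identityʳ a))

  ⟨⟩-cong : ∀ {a b} → a ≈ b → ⟨ a ⟩ ≐ ⟨ b ⟩
  ⟨⟩-cong a≈b x = (λ (lift (n , x≈na)) → lift (n , trans x≈na (×-congʳ n a≈b)))
                , (λ (lift (n , x≈nb)) → lift (n , trans x≈nb (×-congʳ n (sym a≈b))))

  ⟨-a⟩≐⟨a⟩ : ∀ a → ⟨ - a ⟩ ≐ ⟨ a ⟩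
  ⟨-a⟩≐⟨a⟩ a x = ⟨-⟩⊆⟨⟩ , (λ x∈⟨a⟩ → ⟨-⟩⊆⟨⟩ (proj₂ (⟨⟩-cong (-‿involutive a) x) x∈⟨a⟩))
    where
    ⟨-⟩⊆⟨⟩ : ∀ {b} → ⟨ - b ⟩ x → ⟨ b ⟩ x
    ⟨-⟩⊆⟨⟩ {b} (lift (n , x≈n[-b])) =
      lift (n ℕ.* (p ∸ 1) , trans x≈n[-b] (trans (×-congʳ n (-x≈[p∸1]·x b)) (×-assocˡ b n (p ∸ 1))))

  φ₁[⟨a⟩]≐⟨φ₁a⟩ : ∀ a → φ₁[ ⟨ a ⟩ ] ≐ ⟨ φ₁ a ⟩
  φ₁[⟨a⟩]≐⟨φ₁a⟩ a x =
      (λ (y , lift (n , y≈na) , x≈φy) → lift (n , trans x≈φy (trans (φ₁-cong y≈na) (φ₁-· n a))))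
    , (λ (lift (n , x≈nφa)) → n · a , lift (n , refl) , trans x≈nφa (sym (φ₁-· n a)))

  φ₁-BijOn : ∀ a → BijOn ⟨ a ⟩ ⟨ φ₁ a ⟩
  φ₁-BijOn a = (λ x x∈⟨a⟩ → proj₁ (φ₁[⟨a⟩]≐⟨φ₁a⟩ a (φ₁ x)) (x , x∈⟨a⟩ , refl))
             , (λ _ _ _ _ → φ₁-injective)
             , (λ y (lift (n , y≈nφa)) → n · a , lift (n , refl) , trans (φ₁-· n a) (sym y≈nφa))

  ⟨φ₁a⟩≐⟨a⟩⇒Stable : ∀ a → ⟨ φ₁ a ⟩ ≐ ⟨ a ⟩ → Stable ⟨ a ⟩
  ⟨φ₁a⟩≐⟨a⟩⇒Stable a = ≐-trans (φ₁[⟨a⟩]≐⟨φ₁a⟩ a)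

  φ₁φ₁≈^p*p : ∀ x → φ₁ (φ₁ x) ≈ x ^ (p ℕ.* p)
  φ₁φ₁≈^p*p x = ^-assocʳ x p p

  G⇒φ₁φ₁≈- : ∀ {a} → G a → φ₁ (φ₁ a) ≈ - a
  G⇒φ₁φ₁≈- {a} (lift a^p²+a≈0) = trans (φ₁φ₁≈^p*p a) (+-inverseˡ-unique _ a a^p²+a≈0)

  G-φ₁ : ∀ {a} → G a → G (φ₁ a)
  G-φ₁ {a} (lift a^p²+a≈0) = lift (begin
    φ₁ a ^ (p ℕ.* p) + φ₁ a      ≈⟨ +-congʳ (^-comm a p (p ℕ.* p)) ⟩
    φ₁ (a ^ (p ℕ.* p)) + φ₁ a    ≈⟨ φ₁-+ _ a ⟨
    φ₁ (a ^ (p ℕ.* p) + a)       ≈⟨ φ₁-cong a^p²+a≈0 ⟩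
    φ₁ 0#                        ≈⟨ φ₁-0 ⟩
    0#                           ∎)

  IsFp√-1 : Carrier → Set ℓ
  IsFp√-1 ε = φ₁ ε ≈ ε × ε * ε ≈ - 1#

  -‿Fp√-1 : ∀ {ε} → IsFp√-1 ε → IsFp√-1 (- ε)
  -‿Fp√-1 {ε} (φε≈ε , ε*ε≈-1) =
    trans (φ₁-‿ ε) (-‿cong φε≈ε) , trans (solve 1 (λ e → (:- e) :* (:- e) := e :* e) refl ε) ε*ε≈-1

  Sol⇒φ₁φ₁≈- : ∀ {ε x} → IsFp√-1 ε → Sol ε x → φ₁ (φ₁ x) ≈ - x
  Sol⇒φ₁φ₁≈- {ε} {x} (φε≈ε , ε*ε≈-1) (lift φx≈εx) = begin
    φ₁ (φ₁ x)          ≈⟨ φ₁-cong φx≈εx ⟩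
    φ₁ (ε * x)         ≈⟨ φ₁-* ε x ⟩
    φ₁ ε * φ₁ x        ≈⟨ *-cong φε≈ε φx≈εx ⟩
    ε * (ε * x)        ≈⟨ √-1*[√-1*x]≈-x ε*ε≈-1 x ⟩
    - x                ∎

  Sol⊆G : ∀ {ε x} → IsFp√-1 ε → Sol ε x → G x
  Sol⊆G {x = x} ε-√-1 x∈Sol =
    lift (trans (+-congʳ (trans (sym (φ₁φ₁≈^p*p x)) (Sol⇒φ₁φ₁≈- ε-√-1 x∈Sol))) (-‿inverseˡ x))

  Sol-stable : ∀ {ε} → IsFp√-1 ε → Stable (Sol ε)
  Sol-stable {ε} ε-√-1@(φε≈ε , ε*ε≈-1) x = φ₁[Sol]⊆Sol , Sol⊆φ₁[Sol]
    where
    φ₁[Sol]⊆Sol : φ₁[ Sol ε ] x → Sol ε x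
    φ₁[Sol]⊆Sol (y , lift φy≈εy , x≈φy) = lift (begin
      φ₁ x          ≈⟨ φ₁-cong x≈φy ⟩
      φ₁ (φ₁ y)     ≈⟨ φ₁-cong φy≈εy ⟩
      φ₁ (ε * y)    ≈⟨ φ₁-* ε y ⟩
      φ₁ ε * φ₁ y   ≈⟨ *-cong φε≈ε (sym x≈φy) ⟩
      ε * x         ∎)
    Sol⊆φ₁[Sol] : Sol ε x → φ₁[ Sol ε ] x
    Sol⊆φ₁[Sol] (lift φx≈εx) = y , lift (trans φy≈x (sym εy≈x)) , sym φy≈x
      where
      y = - (ε * x)
      εy≈x : ε * y ≈ x
      εy≈x = trans (sym (-‿distribʳ-* ε (ε * x))) (trans (-‿cong (√-1*[√-1*x]≈-x ε*ε≈-1 x)) (-‿involutive x))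
      φy≈x : φ₁ y ≈ x
      φy≈x = trans (φ₁-‿ (ε * x)) (trans (-‿cong (trans (φ₁-* ε x) (*-cong φε≈ε φx≈εx)))
                   (trans (-‿cong (√-1*[√-1*x]≈-x ε*ε≈-1 x)) (-‿involutive x)))

  ⟨a⟩≐Sol : ∀ {ε a} → IsFp√-1 ε → a ≉ 0# → φ₁ a ≈ ε * a → ⟨ a ⟩ ≐ Sol ε
  ⟨a⟩≐Sol {ε} {a} (φε≈ε , ε*ε≈-1) a≉0 φa≈εa x = ⟨a⟩⊆Sol , Sol⊆⟨a⟩
    where
    ⟨a⟩⊆Sol : ⟨ a ⟩ x → Sol ε x
    ⟨a⟩⊆Sol (lift (n , x≈na)) = lift (begin
      φ₁ x          ≈⟨ φ₁-cong x≈na ⟩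
      φ₁ (n · a)    ≈⟨ φ₁-· n a ⟩
      n · φ₁ a      ≈⟨ ×-congʳ n φa≈εa ⟩
      n · (ε * a)   ≈⟨ ×-comm-* n ε a ⟨
      ε * (n · a)   ≈⟨ *-congˡ x≈na ⟨
      ε * x         ∎)
    -- the quotient t = x / a of a solution is fixed by φ₁, hence lies in the prime field
    a⁻¹ = proj₁ (inverse a a≉0)
    t = x * a⁻¹
    ta≈x : t * a ≈ x
    ta≈x = trans (*-assoc x a⁻¹ a) (trans (*-congˡ (trans (*-comm a⁻¹ a) (proj₂ (inverse a a≉0)))) (*-identityʳ x))
    φt≈t : Sol ε x → φ₁ t ≈ t
    φt≈t (lift φx≈εx) = *-cancelʳ (*-≉0 (√-1≉0 ε*ε≈-1) a≉0) (begin
      φ₁ t * (ε * a)   ≈⟨ *-congˡ φa≈εa ⟨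
      φ₁ t * φ₁ a      ≈⟨ φ₁-* t a ⟨
      φ₁ (t * a)       ≈⟨ φ₁-cong ta≈x ⟩
      φ₁ x             ≈⟨ φx≈εx ⟩
      ε * x            ≈⟨ *-congˡ ta≈x ⟨
      ε * (t * a)      ≈⟨ x∙yz≈y∙xz ε t a ⟩
      t * (ε * a)      ∎)
    Sol⊆⟨a⟩ : Sol ε x → ⟨ a ⟩ x
    Sol⊆⟨a⟩ x∈Sol = let n , t≈n = fixed⇒·1 (φt≈t x∈Sol) in
      lift (n , trans (sym ta≈x) (trans (*-congʳ t≈n) (sym (·≈·1* n a))))

  φ₁⁴≈id : ∀ x → φ₁ (φ₁ (φ₁ (φ₁ x))) ≈ x
  φ₁⁴≈id x = trans (φ₁ⁿ≈^pⁿ 4 x) (fermat x)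

  -- U ε = (φ₁ + ε)(φ₁² − 1)
  U : Carrier → Carrier → Carrier
  U ε x = (φ₁ (φ₁ (φ₁ x)) + ε * φ₁ (φ₁ x)) - (φ₁ x + ε * x)

  φ₁-U : ∀ {ε} → IsFp√-1 ε → ∀ x → φ₁ (U ε x) ≈ ε * U ε x
  φ₁-U {ε} (φε≈ε , ε*ε≈-1) x = begin
    φ₁ ((A + ε * B) - (C + ε * x))                ≈⟨ φ₁-sub (A + ε * B) (C + ε * x) ⟩
    φ₁ (A + ε * B) - φ₁ (C + ε * x)               ≈⟨ +-cong (φ₁-+ε* A B) (-‿cong (φ₁-+ε* C x)) ⟩
    (φ₁ A + ε * A) - (B + ε * C)                  ≈⟨ +-congʳ (+-congʳ (φ₁⁴≈id x)) ⟩
    (x + ε * A) - (B + ε * C)                     ≈⟨ solve 5 (λ x e A B C → (x :+ e :* A) :- (B :+ e :* C)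
                                                       := (e :* A :- B) :- (e :* C :- x)) refl x ε A B C ⟩
    (ε * A - B) - (ε * C - x)                     ≈⟨ +-cong (ε*[a+εb]≈εa-b A B) (-‿cong (ε*[a+εb]≈εa-b C x)) ⟨
    ε * (A + ε * B) - ε * (C + ε * x)             ≈⟨ x[y-z]≈xy-xz ε _ _ ⟨
    ε * ((A + ε * B) - (C + ε * x))               ∎
    where
    A = φ₁ (φ₁ (φ₁ x))
    B = φ₁ (φ₁ x)
    C = φ₁ x
    φ₁-sub : ∀ a b → φ₁ (a - b) ≈ φ₁ a - φ₁ b
    φ₁-sub a b = trans (φ₁-+ a (- b)) (+-congˡ (φ₁-‿ b))
    φ₁-+ε* : ∀ a b → φ₁ (a + ε * b) ≈ φ₁ a + ε * φ₁ b
    φ₁-+ε* a b = trans (φ₁-+ a (ε * b)) (+-congˡ (trans (φ₁-* ε b) (*-congʳ φε≈ε)))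
    ε*[a+εb]≈εa-b : ∀ a b → ε * (a + ε * b) ≈ ε * a - b
    ε*[a+εb]≈εa-b a b = trans (distribˡ ε a (ε * b)) (+-congˡ (√-1*[√-1*x]≈-x ε*ε≈-1 b))

  private
    1<p : 1 ℕ.< p
    1<p = ℕ.nonTrivial⇒n>1 p {{prime⇒nonTrivial p-prime}}

    p^<p^ : ∀ {m n} → m ℕ.< n → p ℕ.^ m ℕ.< p ℕ.^ n
    p^<p^ = ℕ.^-monoʳ-< p 1<p

  U-coefficients : Carrier → Vec Carrier (p ℕ.^ 3)
  U-coefficients ε =
    zipWith _+_ (monomial (p ℕ.^ 2) ε) (zipWith _+_ (monomial (p ℕ.^ 1) (- 1#)) (monomial (p ℕ.^ 0) (- ε)))

  U≈monic : ∀ ε x → U ε x ≈ monic (U-coefficients ε) x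
  U≈monic ε x = sym (begin
    monic (U-coefficients ε) x                                         ≈⟨ monic≈^+eval (U-coefficients ε) x ⟩
    x ^ (p ℕ.^ 3) + eval (U-coefficients ε) x
      ≈⟨ +-congˡ (trans (eval-+ (term 2 ε) _ x) (+-congˡ (eval-+ (term 1 (- 1#)) (term 0 (- ε)) x))) ⟩
    x ^ (p ℕ.^ 3) + (eval (term 2 ε) x + (eval (term 1 (- 1#)) x + eval (term 0 (- ε)) x))
      ≈⟨ +-congˡ (+-cong (eval-term 2 (s<s (s<s z<s)) ε) (+-cong (eval-term 1 (s<s z<s) (- 1#)) (eval-term 0 z<s (- ε)))) ⟩
    x ^ (p ℕ.^ 3) + (ε * x ^ (p ℕ.^ 2) + ((- 1#) * x ^ (p ℕ.^ 1) + (- ε) * x ^ (p ℕ.^ 0)))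
      ≈⟨ +-cong (φ₁ⁿ≈^pⁿ 3 x) (+-cong (*-congˡ (φ₁ⁿ≈^pⁿ 2 x))
                 (+-cong (trans (-‿cong (φ₁ⁿ≈^pⁿ 1 x)) (sym (-1*x≈-x _))) (*-congˡ (φ₁ⁿ≈^pⁿ 0 x)))) ⟨
    A + (ε * B + (- C + (- ε) * x))
      ≈⟨ solve 5 (λ A e B C x → A :+ (e :* B :+ (:- C :+ (:- e) :* x)) := (A :+ e :* B) :- (C :+ e :* x)) refl A ε B C x ⟩
    U ε x                                                              ∎)
    where
    A = φ₁ (φ₁ (φ₁ x))
    B = φ₁ (φ₁ x)
    C = φ₁ x
    term : ℕ → Carrier → Vec Carrier (p ℕ.^ 3)
    term i a = monomial (p ℕ.^ i) a
    eval-term : ∀ i → i ℕ.< 3 → ∀ a → eval (term i a) x ≈ a * x ^ (p ℕ.^ i)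
    eval-term i i<3 a = eval-monomial {p ℕ.^ 3} (p^<p^ {i} {3} i<3) a x

  ∃-eigenvector : ∀ {ε} → IsFp√-1 ε → ∃ λ a → a ≉ 0# × φ₁ a ≈ ε * a
  ∃-eigenvector {ε} ε-√-1 =
    let x , monic≉0 = ∃-nonroot (p^<p^ {3} {4} (s<s (s<s (s<s z<s)))) (U-coefficients ε)
    in U ε x , (λ U≈0 → monic≉0 (trans (sym (U≈monic ε x)) U≈0)) , φ₁-U ε-√-1 x

  ∃-generator : ∀ {ε} → IsFp√-1 ε → ∃ λ a → Gen a × (⟨ a ⟩ ≐ Sol ε)
  ∃-generator ε-√-1 = let a , a≉0 , φa≈εa = ∃-eigenvector ε-√-1 in
    a , (Sol⊆G ε-√-1 (lift φa≈εa) , a≉0) , ⟨a⟩≐Sol ε-√-1 a≉0 φa≈εa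

  stable⇒eigen : ∀ {a} → Stable ⟨ a ⟩ → ∃ λ n → φ₁ a ≈ (n · 1#) * a
  stable⇒eigen {a} stable = let lift (n , φa≈na) = proj₁ (stable (φ₁ a)) (a , a∈⟨a⟩ a , refl) in
    n , trans φa≈na (·≈·1* n a)

  eigenvalue-√-1 : ∀ {a κ} → Gen a → φ₁ κ ≈ κ → φ₁ a ≈ κ * a → κ * κ ≈ - 1#
  eigenvalue-√-1 {a} {κ} (a∈G , a≉0) φκ≈κ φa≈κa = *-cancelʳ a≉0 (begin
    (κ * κ) * a       ≈⟨ *-assoc κ κ a ⟩
    κ * (κ * a)       ≈⟨ *-cong φκ≈κ φa≈κa ⟨
    φ₁ κ * φ₁ a       ≈⟨ φ₁-* κ a ⟨
    φ₁ (κ * a)        ≈⟨ φ₁-cong φa≈κa ⟨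
    φ₁ (φ₁ a)         ≈⟨ G⇒φ₁φ₁≈- a∈G ⟩
    - a               ≈⟨ -1*x≈-x a ⟨
    - 1# * a          ∎)

  stable⇒Sol : ∀ {ε} → IsFp√-1 ε → ∀ a → Gen a → Stable ⟨ a ⟩ →
               (⟨ a ⟩ ≐ Sol ε) ⊎ (⟨ a ⟩ ≐ Sol (- ε))
  stable⇒Sol ε-√-1@(_ , ε*ε≈-1) a a∈Gen@(_ , a≉0) stable =
    let n , φa≈κa = stable⇒eigen stable
        eigen-Sol : ∀ {ε′} → IsFp√-1 ε′ → n · 1# ≈ ε′ → ⟨ a ⟩ ≐ Sol ε′
        eigen-Sol ε′-√-1 κ≈ε′ = ⟨a⟩≐Sol ε′-√-1 a≉0 (trans φa≈κa (*-congʳ κ≈ε′))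
    in Sum.map (eigen-Sol ε-√-1) (eigen-Sol (-‿Fp√-1 ε-√-1))
               (√-1≈± _≟_ ε*ε≈-1 (eigenvalue-√-1 a∈Gen (φ₁-·1 n) φa≈κa))

  Sol⇒stable : ∀ {ε} → IsFp√-1 ε → ∀ a → (⟨ a ⟩ ≐ Sol ε) ⊎ (⟨ a ⟩ ≐ Sol (- ε)) → Stable ⟨ a ⟩
  Sol⇒stable ε-√-1 a (inj₁ ⟨a⟩≐Sol) = Stable-resp-≐ ⟨a⟩≐Sol (Sol-stable ε-√-1)
  Sol⇒stable ε-√-1 a (inj₂ ⟨a⟩≐Sol) = Stable-resp-≐ ⟨a⟩≐Sol (Sol-stable (-‿Fp√-1 ε-√-1))

  Sol≉Sol-‿ : ∀ {ε} → IsFp√-1 ε → ¬ (Sol ε ≐ Sol (- ε))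
  Sol≉Sol-‿ {ε} ε-√-1@(_ , ε*ε≈-1) Sol≐Sol =
    let a , a≉0 , φa≈εa = ∃-eigenvector ε-√-1
        φa≈-εa = lower (proj₁ (Sol≐Sol a) (lift φa≈εa))
    in ×1≉0 {2} (s≤s z≤n) 2<p (x*y≈0⇒y≈0 (*-≉0 (√-1≉0 ε*ε≈-1) a≉0) (begin
      (ε * a) * (2 · 1#)         ≈⟨ solve 2 (λ e a → (e :* a) :* con (+ 2) := e :* a :- (:- e) :* a) refl ε a ⟩
      ε * a - (- ε) * a          ≈⟨ +-cong (sym φa≈εa) (-‿cong (sym φa≈-εa)) ⟩
      φ₁ a - φ₁ a                ≈⟨ -‿inverseʳ (φ₁ a) ⟩
      0#                         ∎))

  unstable⇒paired : ∀ a → Gen a → ¬ Stable ⟨ a ⟩ →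
    ∃ λ b → Gen b × (φ₁[ ⟨ a ⟩ ] ≐ ⟨ b ⟩) × ¬ (⟨ b ⟩ ≐ ⟨ a ⟩)
            × (φ₁[ ⟨ b ⟩ ] ≐ ⟨ a ⟩) × BijOn ⟨ a ⟩ ⟨ b ⟩
  unstable⇒paired a (a∈G , a≉0) unstable =
    φ₁ a , (G-φ₁ a∈G , λ φa≈0 → a≉0 (^≈0⇒≈0 _≟_ p φa≈0))
    , φ₁[⟨a⟩]≐⟨φ₁a⟩ a
    , (λ ⟨φa⟩≐⟨a⟩ → unstable (⟨φ₁a⟩≐⟨a⟩⇒Stable a ⟨φa⟩≐⟨a⟩))
    , ≐-trans (φ₁[⟨a⟩]≐⟨φ₁a⟩ (φ₁ a)) (≐-trans (⟨⟩-cong (G⇒φ₁φ₁≈- a∈G)) (⟨-a⟩≐⟨a⟩ a))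
    , φ₁-BijOn a

  u₁-Fp√-1 : IsFp√-1 u₁
  u₁-Fp√-1 = φ₁-·1 (((p ∸ 1) ℕ./ 2) !) , (begin
    u₁ * u₁                                  ≡⟨ ≡.cong (λ n → ((n !) · 1#) * ((n !) · 1#)) [p∸1]/2≡k ⟩
    ((k !) · 1#) * ((k !) · 1#)              ≈⟨ *-identityˡ _ ⟨
    1# * (((k !) · 1#) * ((k !) · 1#))       ≈⟨ *-congʳ (trans (-x^[k*2]≈x^[k*2] e 1#) (1^n≈1 k)) ⟨
    (- 1#) ^ k * (((k !) · 1#) * ((k !) · 1#)) ≈⟨ wilson-half ⟩
    - 1#                                     ∎)

open import Data.Nat using (_^_)

theorem4p7 : ∀ {c ℓ} (p : ℕ) → Prime p → 4 ∣ (p ∸ 1) →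
    (F : CommutativeRing c ℓ) → IsField F → HasOrder F (p ^ 4) →
    let open CommutativeRing F using (-_)
        open Notions F p
    in
    -- exactly two of the G_i are φ₁-stable, namely Sol u₁ and Sol (-u₁)
    ((∀ a → Gen a → (Stable ⟨ a ⟩ → (⟨ a ⟩ ≐ Sol u₁) ⊎ (⟨ a ⟩ ≐ Sol (- u₁)))
                  × ((⟨ a ⟩ ≐ Sol u₁) ⊎ (⟨ a ⟩ ≐ Sol (- u₁)) → Stable ⟨ a ⟩))
     × (∃ λ a → Gen a × (⟨ a ⟩ ≐ Sol u₁))
     × (∃ λ a → Gen a × (⟨ a ⟩ ≐ Sol (- u₁)))
     × ¬ (Sol u₁ ≐ Sol (- u₁)))
    ×
    -- a non-stable G_i is mapped onto another G_j, which is mapped back onto G_i,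
    -- and φ₁ is a bijection G_i → G_j
    (∀ a → Gen a → ¬ Stable ⟨ a ⟩ →
      ∃ λ b → Gen b × (φ₁[ ⟨ a ⟩ ] ≐ ⟨ b ⟩) × ¬ (⟨ b ⟩ ≐ ⟨ a ⟩)
              × (φ₁[ ⟨ b ⟩ ] ≐ ⟨ a ⟩) × BijOn ⟨ a ⟩ ⟨ b ⟩)
theorem4p7 p p-prime 4∣p∸1 F isField order =
  ( (λ a a∈Gen → stable⇒Sol u₁-Fp√-1 a a∈Gen , Sol⇒stable u₁-Fp√-1 a)
  , ∃-generator u₁-Fp√-1
  , ∃-generator (-‿Fp√-1 u₁-Fp√-1)
  , Sol≉Sol-‿ u₁-Fp√-1 )
  , unstable⇒paired
  where open FrobeniusOnG p-prime 4∣p∸1 F isField order
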